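{- Let $n\geq 4$, let ${}_{n}w=[n,1,2,\dots,n-4,n-2,n-1,n-3]\in\mathfrak{S}_n$ (i.e. ${}_{n}w(1)=n$, ${}_{n}w(i)=i-1$ for $2\leq i\leq n-3$, ${}_{n}w(n-2)=n-2$, ${}_{n}w(n-1)=n-1$, ${}_{n}w(n)=n-3$), and let $\sigma\in\mathfrak{S}_n$ be its reverse, $\sigma(i)={}_{n}w(n+1-i)$. Then the number $r({}_{n}w)$ of reduced words of ${}_{n}w$ satisfies $r({}_{n}w)=\ell({}_{n}w)+\ell(\sigma)$.
   Context: $\ell(w)$ is the number of inversions of $w$. A reduced word of $w$ is a sequence $a_1\cdots a_p$ with $w=s_{a_1}\cdots s_{a_p}$, $s_i$ the simple transposition exchanging $i,i+1$, and $p=\ell(w)$. -}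

module Defs where

open import Data.Nat using (ℕ; zero; suc; _+_; _∸_; _<ᵇ_; _≡ᵇ_; _≤ᵇ_; _≟_)
open import Data.Bool using (Bool; true; false; if_then_else_; _∧_)
open import Data.List using (List; []; _∷_; map; concatMap; filter; length; upTo; foldr)
open import Data.Nat.ListAction using (sum)
open import Relation.Nullary using (Dec)
open import Data.List.Relation.Unary.All using (All)
open import Data.List.Relation.Unary.All using (all?)
open import Function using (id; _∘_)
open import Relation.Binary.PropositionalEquality using (_≡_)

-- Permutations of {1,…,n} are represented as functions ℕ → ℕ; only
-- their values on 1,…,n matter.

range : ℕ → List ℕ
range m = map suc (upTo m)

s : ℕ → ℕ → ℕ
s a i = if i ≡ᵇ a then suc a else (if i ≡ᵇ suc a then a else i)

wordPerm : List ℕ → ℕ → ℕ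
wordPerm = foldr (λ a f → s a ∘ f) id

inv : ℕ → (ℕ → ℕ) → ℕ
inv n w = sum (map (λ i → sum (map (λ j → if (i <ᵇ j) ∧ (w j <ᵇ w i) then 1 else 0) (range n))) (range n))

words : ℕ → List ℕ → List (List ℕ)
words zero as = [] ∷ []
words (suc p) as = concatMap (λ a → map (a ∷_) (words p as)) as

Represents : ℕ → (ℕ → ℕ) → List ℕ → Set
Represents n w ws = All (λ i → wordPerm ws i ≡ w i) (range n)

represents? : ∀ n w ws → Dec (Represents n w ws)
represents? n w ws = all? (λ i → wordPerm ws i ≟ w i) (range n)

redWords : ℕ → (ℕ → ℕ) → ℕ
redWords n w = length (filter (represents? n w) (words (inv n w) (range (n ∸ 1))))

nw : ℕ → ℕ → ℕ
nw n i =
  if i ≡ᵇ 1 then n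
  else if (2 ≤ᵇ i) ∧ (i ≤ᵇ n ∸ 3) then i ∸ 1
  else if i ≡ᵇ n ∸ 2 then n ∸ 2
  else if i ≡ᵇ n ∸ 1 then n ∸ 1
  else if i ≡ᵇ n then n ∸ 3
  else i

σ : ℕ → ℕ → ℕ
σ n i = nw n (suc n ∸ i)

-- ₙw = [n, 1, …, n-4, n-2, n-1, n-3] lies in the family of permutations [x, …, y] whose entries
-- between the first and the last one increase. Reduced words satisfy the left-descent recursion
-- r(w) = Σ_{a ∈ D_L(w)} r(s_a w), since removing the first letter of a reduced word of w leaves one of
-- s_a w of length ℓ(w) - 1, which forces a to be a descent. The only left descents of [x, …, y] are
-- x - 1 and y, and s_{x-1} resp. s_y moves x down resp. y up inside the family. For x < y this counts
-- the shuffles of two chains, C(x - 1 + n - y, x - 1); for x > y a second recursion reduces to that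
-- case, and for ₙw the result is C(n, 2). On the other side ℓ(w) + ℓ(σ) = C(n, 2) for every w, because
-- each pair i < j is an inversion of exactly one of w and its reverse σ.

module Submission where

open import Defs
open import Data.Bool using (Bool; true; false; if_then_else_; _∧_)
open import Data.Bool.Properties using (∧-zeroʳ; ∧-identityʳ)
open import Data.Nat using (ℕ; zero; suc; _+_; _*_; _∸_; _<ᵇ_; _≡ᵇ_; _≤ᵇ_; _≤_; _<_; z≤n; s≤s)
open import Data.Nat.Properties
open import Algebra.Properties.CommutativeSemigroup +-commutativeSemigroup using (interchange)
open import Data.List using ([]; _∷_; [_]; _++_; map; concatMap; filter; length; upTo)
open import Data.List.Properties
  using (upTo-∷ʳ; map-++; length-++; filter-++; filter-≐; filter-accept; filter-none)
open import Data.List.Membership.Propositional using (_∈_)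
open import Data.List.Membership.Propositional.Properties using (∈-map⁺; ∈-map⁻; ∈-upTo⁺; ∈-upTo⁻)
open import Data.List.Relation.Unary.All as All using (All; []; _∷_)
open import Data.List.Relation.Unary.All.Properties using (++⁺; map⁺)
open import Relation.Unary using (Decidable; _≐_; _⊆_)
open import Data.Nat.ListAction using (sum)
open import Data.Nat.ListAction.Properties using (sum-++)
open import Data.Product using (_×_; _,_; proj₁; proj₂; ∃-syntax)
open import Data.Sum using (_⊎_; inj₁; inj₂)
open import Function using (id; _∘_)
open import Relation.Binary.PropositionalEquality hiding ([_])
open import Relation.Nullary using (¬_; yes; no; does; contradiction)
open import Relation.Nullary.Decidable using (dec-true; dec-false; _×-dec_)

𝟙 : Bool → ℕ
𝟙 b = if b then 1 else 0

≡ᵇ-true : ∀ {m n} → m ≡ n → (m ≡ᵇ n) ≡ true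
≡ᵇ-true = dec-true (_ ≟ _)

≡ᵇ-false : ∀ {m n} → m ≢ n → (m ≡ᵇ n) ≡ false
≡ᵇ-false = dec-false (_ ≟ _)

<ᵇ-true : ∀ {m n} → m < n → (m <ᵇ n) ≡ true
<ᵇ-true = dec-true (_ <? _)

<ᵇ-false : ∀ {m n} → ¬ m < n → (m <ᵇ n) ≡ false
<ᵇ-false = dec-false (_ <? _)

≤ᵇ-true : ∀ {m n} → m ≤ n → (m ≤ᵇ n) ≡ true
≤ᵇ-true = dec-true (_ ≤? _)

≤ᵇ-false : ∀ {m n} → ¬ m ≤ n → (m ≤ᵇ n) ≡ false
≤ᵇ-false = dec-false (_ ≤? _)

≡ᵇ-∧-false : ∀ {m n k l} → ¬ (m ≡ n × k ≡ l) → ((m ≡ᵇ n) ∧ (k ≡ᵇ l)) ≡ false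
≡ᵇ-∧-false {m} {n} not-both with m ≟ n
... | yes m≡n rewrite ≡ᵇ-true m≡n = ≡ᵇ-false λ k≡l → not-both (m≡n , k≡l)
... | no m≢n  rewrite ≡ᵇ-false m≢n = refl


sumTo : ℕ → (ℕ → ℕ) → ℕ
sumTo zero    h = 0
sumTo (suc n) h = sumTo n h + h (suc n)

sum-map-range : ∀ n h → sum (map h (range n)) ≡ sumTo n h
sum-map-range zero    h = refl
sum-map-range (suc n) h = begin
  sum (map h (range (suc n)))             ≡⟨ cong (sum ∘ map h ∘ map suc) (upTo-∷ʳ n) ⟨
  sum (map h (map suc (upTo n ++ [ n ]))) ≡⟨ cong (sum ∘ map h) (map-++ suc (upTo n) [ n ]) ⟩
  sum (map h (range n ++ [ suc n ]))      ≡⟨ cong sum (map-++ h (range n) [ suc n ]) ⟩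
  sum (map h (range n) ++ [ h (suc n) ])  ≡⟨ sum-++ (map h (range n)) [ h (suc n) ] ⟩
  sum (map h (range n)) + (h (suc n) + 0) ≡⟨ cong₂ _+_ (sum-map-range n h) (+-identityʳ _) ⟩
  sumTo n h + h (suc n)                   ∎
  where open ≡-Reasoning

sumTo-cong : ∀ n {h k : ℕ → ℕ} → (∀ i → 1 ≤ i → i ≤ n → h i ≡ k i) → sumTo n h ≡ sumTo n k
sumTo-cong zero    eq = refl
sumTo-cong (suc n) eq =
  cong₂ _+_ (sumTo-cong n λ i i≥1 i≤n → eq i i≥1 (m≤n⇒m≤1+n i≤n)) (eq (suc n) (s≤s z≤n) ≤-refl)

sumTo-zero : ∀ n {h : ℕ → ℕ} → (∀ i → 1 ≤ i → i ≤ n → h i ≡ 0) → sumTo n h ≡ 0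
sumTo-zero zero    eq = refl
sumTo-zero (suc n) eq =
  cong₂ _+_ (sumTo-zero n λ i i≥1 i≤n → eq i i≥1 (m≤n⇒m≤1+n i≤n)) (eq (suc n) (s≤s z≤n) ≤-refl)

sumTo-ones : ∀ n {h : ℕ → ℕ} → (∀ i → 1 ≤ i → i ≤ n → h i ≡ 1) → sumTo n h ≡ n
sumTo-ones zero    eq = refl
sumTo-ones (suc n) eq = trans (cong₂ _+_ (sumTo-ones n λ i i≥1 i≤n → eq i i≥1 (m≤n⇒m≤1+n i≤n))
                                         (eq (suc n) (s≤s z≤n) ≤-refl)) (+-comm n 1)

sumTo-distrib-+ : ∀ n (h k : ℕ → ℕ) → sumTo n (λ i → h i + k i) ≡ sumTo n h + sumTo n k
sumTo-distrib-+ zero    h k = refl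
sumTo-distrib-+ (suc n) h k rewrite sumTo-distrib-+ n h k =
  interchange (sumTo n h) (sumTo n k) (h (suc n)) (k (suc n))

sumTo-comm : ∀ m n (h : ℕ → ℕ → ℕ) →
             sumTo m (λ i → sumTo n (h i)) ≡ sumTo n (λ j → sumTo m (λ i → h i j))
sumTo-comm zero    n h = sym (sumTo-zero n λ _ _ _ → refl)
sumTo-comm (suc m) n h = trans (cong (_+ sumTo n (h (suc m))) (sumTo-comm m n h))
                               (sym (sumTo-distrib-+ n _ (h (suc m))))

sumTo-unfoldˡ : ∀ n h → sumTo (suc n) h ≡ h 1 + sumTo n (h ∘ suc)
sumTo-unfoldˡ zero    h = +-comm 0 (h 1)
sumTo-unfoldˡ (suc n) h = trans (cong (_+ h (2 + n)) (sumTo-unfoldˡ n h)) (+-assoc (h 1) _ _)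

sumTo-reflect : ∀ n h → sumTo n h ≡ sumTo n (λ i → h (suc n ∸ i))
sumTo-reflect zero    h = refl
sumTo-reflect (suc n) h = begin
  sumTo n h + h (suc n)                         ≡⟨ cong (_+ h (suc n)) (sumTo-reflect n h) ⟩
  sumTo n (λ i → h (suc n ∸ i)) + h (suc n)     ≡⟨ +-comm _ (h (suc n)) ⟩
  h (suc n) + sumTo n (λ i → h (suc n ∸ i))     ≡⟨ sumTo-unfoldˡ n (λ i → h (2 + n ∸ i)) ⟨
  sumTo (suc n) (λ i → h (2 + n ∸ i))           ∎
  where open ≡-Reasoning

≤suc∧≢⇒≤ : ∀ {i n} → i ≤ suc n → i ≢ suc n → i ≤ n
≤suc∧≢⇒≤ i≤1+n i≢1+n = ≤-pred (≤∧≢⇒< i≤1+n i≢1+n)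

sumTo-support₁ : ∀ n {h : ℕ → ℕ} p → 1 ≤ p → p ≤ n →
                 (∀ i → 1 ≤ i → i ≤ n → i ≢ p → h i ≡ 0) → sumTo n h ≡ h p
sumTo-support₁ zero    p p≥1 p≤0 _ = contradiction p≤0 (<⇒≱ p≥1)
sumTo-support₁ (suc n) {h} p p≥1 p≤1+n zero-off with suc n ≟ p
... | yes refl = cong (_+ h p) (sumTo-zero n λ i i≥1 i≤n → zero-off i i≥1 (m≤n⇒m≤1+n i≤n) (<⇒≢ (s≤s i≤n)))
... | no n+1≢p = begin
  sumTo n h + h (suc n) ≡⟨ cong₂ _+_ (sumTo-support₁ n p p≥1 p≤n λ i i≥1 i≤n → zero-off i i≥1 (m≤n⇒m≤1+n i≤n))
                                      (zero-off (suc n) (s≤s z≤n) ≤-refl n+1≢p) ⟩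
  h p + 0               ≡⟨ +-identityʳ (h p) ⟩
  h p                   ∎
  where
  open ≡-Reasoning
  p≤n = ≤suc∧≢⇒≤ p≤1+n (n+1≢p ∘ sym)

sumTo-support₂ : ∀ n {h : ℕ → ℕ} p q → 1 ≤ p → p ≤ n → 1 ≤ q → q ≤ n → p ≢ q →
                 (∀ i → 1 ≤ i → i ≤ n → i ≢ p → i ≢ q → h i ≡ 0) → sumTo n h ≡ h p + h q
sumTo-support₂ zero    p q p≥1 p≤0 _ _ _ _ = contradiction p≤0 (<⇒≱ p≥1)
sumTo-support₂ (suc n) {h} p q p≥1 p≤1+n q≥1 q≤1+n p≢q zero-off with suc n ≟ p | suc n ≟ q
... | yes refl | _ = trans (cong (_+ h p) (sumTo-support₁ n q q≥1 (≤suc∧≢⇒≤ q≤1+n (p≢q ∘ sym))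
                                             λ i i≥1 i≤n → zero-off i i≥1 (m≤n⇒m≤1+n i≤n) (<⇒≢ (s≤s i≤n))))
                           (+-comm (h q) (h p))
... | no _ | yes refl = cong (_+ h q) (sumTo-support₁ n p p≥1 (≤suc∧≢⇒≤ p≤1+n p≢q)
                                        λ i i≥1 i≤n i≢p → zero-off i i≥1 (m≤n⇒m≤1+n i≤n) i≢p (<⇒≢ (s≤s i≤n)))
... | no n+1≢p | no n+1≢q = begin
  sumTo n h + h (suc n) ≡⟨ cong₂ _+_ (sumTo-support₂ n p q p≥1 (≤suc∧≢⇒≤ p≤1+n (n+1≢p ∘ sym)) q≥1
                                        (≤suc∧≢⇒≤ q≤1+n (n+1≢q ∘ sym)) p≢q
                                        λ i i≥1 i≤n → zero-off i i≥1 (m≤n⇒m≤1+n i≤n))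
                                      (zero-off (suc n) (s≤s z≤n) ≤-refl n+1≢p n+1≢q) ⟩
  (h p + h q) + 0       ≡⟨ +-identityʳ _ ⟩
  h p + h q             ∎
  where open ≡-Reasoning

sumTo² : ℕ → (ℕ → ℕ → ℕ) → ℕ
sumTo² n h = sumTo n (λ i → sumTo n (h i))

sumTo²-cong : ∀ n {h k : ℕ → ℕ → ℕ} →
              (∀ i j → 1 ≤ i → i ≤ n → 1 ≤ j → j ≤ n → h i j ≡ k i j) → sumTo² n h ≡ sumTo² n k
sumTo²-cong n eq = sumTo-cong n λ i i≥1 i≤n → sumTo-cong n λ j j≥1 j≤n → eq i j i≥1 i≤n j≥1 j≤n

sumTo²-distrib-+ : ∀ n (h k : ℕ → ℕ → ℕ) → sumTo² n (λ i j → h i j + k i j) ≡ sumTo² n h + sumTo² n k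
sumTo²-distrib-+ n h k = trans (sumTo-cong n λ i _ _ → sumTo-distrib-+ n (h i) (k i)) (sumTo-distrib-+ n _ _)

triangle : ℕ → ℕ
triangle zero    = 0
triangle (suc n) = triangle n + n

pairs-triangle : ∀ n → sumTo² n (λ i j → 𝟙 (i <ᵇ j)) ≡ triangle n
pairs-triangle zero    = refl
pairs-triangle (suc n) = begin
  sumTo² (suc n) (λ i j → 𝟙 (i <ᵇ j))
    ≡⟨ cong (_+ sumTo (suc n) (λ j → 𝟙 (suc n <ᵇ j))) (sumTo-distrib-+ n _ _) ⟩
  (sumTo² n (λ i j → 𝟙 (i <ᵇ j)) + sumTo n (λ i → 𝟙 (i <ᵇ suc n))) + sumTo (suc n) (λ j → 𝟙 (suc n <ᵇ j))
    ≡⟨ cong₂ _+_ (cong₂ _+_ (pairs-triangle n)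
                            (sumTo-ones n λ i _ i≤n → cong 𝟙 (<ᵇ-true (s≤s i≤n))))
                 (sumTo-zero (suc n) λ j _ j≤1+n → cong 𝟙 (<ᵇ-false (≤⇒≯ j≤1+n))) ⟩
  (triangle n + n) + 0
    ≡⟨ +-identityʳ _ ⟩
  triangle (suc n) ∎
  where open ≡-Reasoning


s-left : ∀ a → s a a ≡ suc a
s-left a rewrite ≡ᵇ-true (refl {x = a}) = refl

s-right : ∀ a → s a (suc a) ≡ a
s-right a rewrite ≡ᵇ-false (1+n≢n {a}) | ≡ᵇ-true (refl {x = suc a}) = refl

s-fixed : ∀ a {v} → v ≢ a → v ≢ suc a → s a v ≡ v
s-fixed a v≢a v≢1+a rewrite ≡ᵇ-false v≢a | ≡ᵇ-false v≢1+a = refl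

s-involutive : ∀ a v → s a (s a v) ≡ v
s-involutive a v with v ≟ a | v ≟ suc a
... | yes refl | _        = trans (cong (s a) (s-left a)) (s-right a)
... | no _     | yes refl = trans (cong (s a) (s-right a)) (s-left a)
... | no v≢a   | no v≢1+a = trans (cong (s a) (s-fixed a v≢a v≢1+a)) (s-fixed a v≢a v≢1+a)

s-flip : ∀ a {u v} → s a u ≡ v → s a v ≡ u
s-flip a {u} eq = trans (cong (s a) (sym eq)) (s-involutive a u)

s-≡-left : ∀ a {v} → s a v ≡ a → v ≡ suc a
s-≡-left a {v} eq = trans (sym (s-involutive a v)) (trans (cong (s a) eq) (s-left a))

s-≡-right : ∀ a {v} → s a v ≡ suc a → v ≡ a
s-≡-right a {v} eq = trans (sym (s-involutive a v)) (trans (cong (s a) eq) (s-right a))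

s-range : ∀ {n a v} → 1 ≤ a → suc a ≤ n → 1 ≤ v → v ≤ n → 1 ≤ s a v × s a v ≤ n
s-range {n} {a} {v} a≥1 a<n v≥1 v≤n with v ≟ a | v ≟ suc a
... | yes refl | _        rewrite s-left v  = s≤s z≤n , a<n
... | no _     | yes refl rewrite s-right a = a≥1 , <⇒≤ a<n
... | no v≢a   | no v≢1+a rewrite s-fixed a v≢a v≢1+a = v≥1 , v≤n

s-mono-< : ∀ a {u v} → ¬ (v ≡ a × u ≡ suc a) → v < u → s a v < s a u
s-mono-< a {u} {v} not-pair v<u with v ≟ a | v ≟ suc a | u ≟ a | u ≟ suc a
... | yes refl | _        | _        | yes refl = contradiction (refl , refl) not-pair
... | yes refl | _        | yes refl | _        = contradiction v<u (n≮n v)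
... | yes refl | _        | no u≢a   | no u≢1+a
  rewrite s-left v | s-fixed v u≢a u≢1+a = ≤∧≢⇒< v<u (u≢1+a ∘ sym)
... | no _     | yes refl | no u≢a   | no u≢1+a
  rewrite s-right a | s-fixed a u≢a u≢1+a = <-trans (n<1+n a) v<u
... | no _     | yes refl | yes refl | _        = contradiction (<-trans v<u (n<1+n u)) (n≮n (suc u))
... | no _     | yes refl | no _     | yes refl = contradiction v<u (n≮n u)
... | no v≢a   | no v≢1+a | yes refl | _
  rewrite s-fixed u v≢a v≢1+a | s-left u = <-trans v<u (n<1+n u)
... | no v≢a   | no v≢1+a | no _     | yes refl
  rewrite s-fixed a v≢a v≢1+a | s-right a = ≤∧≢⇒< (≤-pred v<u) v≢a
... | no v≢a   | no v≢1+a | no u≢a   | no u≢1+a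
  rewrite s-fixed a v≢a v≢1+a | s-fixed a u≢a u≢1+a = v<u

s-<ᵇ : ∀ a {u v} → ¬ (v ≡ a × u ≡ suc a) → ¬ (u ≡ a × v ≡ suc a) → (s a v <ᵇ s a u) ≡ (v <ᵇ u)
s-<ᵇ a {u} {v} not-pair not-pair′ with v <? u
... | yes v<u = trans (<ᵇ-true (s-mono-< a not-pair v<u)) (sym (<ᵇ-true v<u))
... | no v≮u  = trans (<ᵇ-false sv≮su) (sym (<ᵇ-false v≮u))
  where
  sv≮su : ¬ s a v < s a u
  sv≮su sv<su = v≮u (subst₂ _<_ (s-involutive a v) (s-involutive a u)
    (s-mono-< a (λ (eq₁ , eq₂) → not-pair′ (s-≡-right a eq₂ , s-≡-left a eq₁)) sv<su))

-- The correction terms account for the only pair of values, {a, a + 1}, whose order s a reverses.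
s-inversion : ∀ a u v → 𝟙 (s a v <ᵇ s a u) + 𝟙 ((u ≡ᵇ suc a) ∧ (v ≡ᵇ a))
                      ≡ 𝟙 (v <ᵇ u) + 𝟙 ((u ≡ᵇ a) ∧ (v ≡ᵇ suc a))
s-inversion a u v with (u ≟ a) ×-dec (v ≟ suc a) | (u ≟ suc a) ×-dec (v ≟ a)
... | yes (refl , refl) | _
  rewrite s-left u | s-right u | <ᵇ-true (n<1+n u) | <ᵇ-false (n≮n u ∘ <-trans (n<1+n u))
        | ≡ᵇ-false (1+n≢n {u} ∘ sym) | ≡ᵇ-true (refl {x = u}) = refl
... | no _ | yes (refl , refl)
  rewrite s-left v | s-right v | <ᵇ-true (n<1+n v) | <ᵇ-false (n≮n v ∘ <-trans (n<1+n v))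
        | ≡ᵇ-false (1+n≢n {v}) | ≡ᵇ-true (refl {x = v}) = refl
... | no not-up | no not-down
  rewrite ≡ᵇ-∧-false not-up | ≡ᵇ-∧-false not-down
        | s-<ᵇ a (λ (v≡a , u≡1+a) → not-down (u≡1+a , v≡a)) not-up = refl


record InverseOn (n : ℕ) (f g : ℕ → ℕ) : Set where
  field
    g-range : ∀ k → 1 ≤ k → k ≤ n → 1 ≤ g k × g k ≤ n
    f∘g     : ∀ k → 1 ≤ k → k ≤ n → f (g k) ≡ k
    g∘f     : ∀ i → 1 ≤ i → i ≤ n → g (f i) ≡ i

  f-injective : ∀ {i j} → 1 ≤ i → i ≤ n → 1 ≤ j → j ≤ n → f i ≡ f j → i ≡ j
  f-injective {i} {j} i≥1 i≤n j≥1 j≤n eq = trans (sym (g∘f i i≥1 i≤n)) (trans (cong g eq) (g∘f j j≥1 j≤n))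

AgreeOn : ℕ → (ℕ → ℕ) → (ℕ → ℕ) → Set
AgreeOn n f f′ = ∀ i → 1 ≤ i → i ≤ n → f i ≡ f′ i

InverseOn-id : ∀ n → InverseOn n id id
InverseOn-id n = record { g-range = λ _ k≥1 k≤n → k≥1 , k≤n ; f∘g = λ _ _ _ → refl ; g∘f = λ _ _ _ → refl }

InverseOn-s∘ : ∀ {n f g a} → 1 ≤ a → suc a ≤ n → InverseOn n f g → InverseOn n (s a ∘ f) (g ∘ s a)
InverseOn-s∘ {n} {f} {g} {a} a≥1 a<n inverse = record
  { g-range = λ k k≥1 k≤n → let (sk≥1 , sk≤n) = s-range a≥1 a<n k≥1 k≤n in g-range (s a k) sk≥1 sk≤n
  ; f∘g     = λ k k≥1 k≤n → let (sk≥1 , sk≤n) = s-range a≥1 a<n k≥1 k≤n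
                            in trans (cong (s a) (f∘g (s a k) sk≥1 sk≤n)) (s-involutive a k)
  ; g∘f     = λ i i≥1 i≤n → trans (cong g (s-involutive a (f i))) (g∘f i i≥1 i≤n)
  }
  where open InverseOn inverse

InverseOn-agree : ∀ {n f f′ g} → AgreeOn n f f′ → InverseOn n f′ g → InverseOn n f g
InverseOn-agree {n} {f} {f′} {g} f≗f′ inverse = record
  { g-range = g-range
  ; f∘g     = λ k k≥1 k≤n → let (gk≥1 , gk≤n) = g-range k k≥1 k≤n
                            in trans (f≗f′ (g k) gk≥1 gk≤n) (f∘g k k≥1 k≤n)
  ; g∘f     = λ i i≥1 i≤n → trans (cong g (f≗f′ i i≥1 i≤n)) (g∘f i i≥1 i≤n)
  }
  where open InverseOn inverse


inversion : (ℕ → ℕ) → ℕ → ℕ → ℕ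
inversion f i j = 𝟙 ((i <ᵇ j) ∧ (f j <ᵇ f i))

inv≡sumTo² : ∀ n f → inv n f ≡ sumTo² n (inversion f)
inv≡sumTo² n f = trans (sum-map-range n _) (sumTo-cong n λ i _ _ → sum-map-range n _)

inv-cong : ∀ n {f f′} → AgreeOn n f f′ → inv n f ≡ inv n f′
inv-cong n {f} {f′} f≗f′ = begin
  inv n f                  ≡⟨ inv≡sumTo² n f ⟩
  sumTo² n (inversion f)   ≡⟨ sumTo²-cong n (λ i j i≥1 i≤n j≥1 j≤n →
                                cong₂ (λ u v → 𝟙 ((i <ᵇ j) ∧ (v <ᵇ u))) (f≗f′ i i≥1 i≤n) (f≗f′ j j≥1 j≤n)) ⟩
  sumTo² n (inversion f′)  ≡⟨ inv≡sumTo² n f′ ⟨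
  inv n f′                 ∎
  where open ≡-Reasoning

inv-id : ∀ n → inv n id ≡ 0
inv-id n = trans (inv≡sumTo² n id) (sumTo-zero n λ i _ _ → sumTo-zero n λ j _ _ → no-inversion i j)
  where
  no-inversion : ∀ i j → inversion id i j ≡ 0
  no-inversion i j with i <? j
  ... | yes i<j rewrite <ᵇ-true i<j | <ᵇ-false (<-asym i<j) = refl
  ... | no i≮j  rewrite <ᵇ-false i≮j = refl

pairAt : (ℕ → ℕ) → ℕ → ℕ → ℕ → ℕ → ℕ
pairAt f c d i j = 𝟙 ((i <ᵇ j) ∧ ((f i ≡ᵇ c) ∧ (f j ≡ᵇ d)))

module _ {n f g} (inverse : InverseOn n f g) where
  open InverseOn inverse

  private
    ≡ᵇ-off : ∀ {i c} → 1 ≤ i → i ≤ n → i ≢ g c → (f i ≡ᵇ c) ≡ false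
    ≡ᵇ-off {i} i≥1 i≤n i≢gc = ≡ᵇ-false λ fi≡c → i≢gc (trans (sym (g∘f i i≥1 i≤n)) (cong g fi≡c))

  pairAt-count : ∀ {c d} → 1 ≤ c → c ≤ n → 1 ≤ d → d ≤ n → sumTo² n (pairAt f c d) ≡ 𝟙 (g c <ᵇ g d)
  pairAt-count {c} {d} c≥1 c≤n d≥1 d≤n = begin
    sumTo² n (pairAt f c d)      ≡⟨ sumTo-support₁ n (g c) gc≥1 gc≤n (λ i i≥1 i≤n i≢gc →
                                      sumTo-zero n λ j _ _ → off-row i≥1 i≤n i≢gc j) ⟩
    sumTo n (pairAt f c d (g c)) ≡⟨ sumTo-support₁ n (g d) gd≥1 gd≤n (λ j j≥1 j≤n j≢gd →
                                      off-column (g c) j≥1 j≤n j≢gd) ⟩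
    pairAt f c d (g c) (g d)     ≡⟨ cong₂ (λ b b′ → 𝟙 ((g c <ᵇ g d) ∧ (b ∧ b′)))
                                      (≡ᵇ-true (f∘g c c≥1 c≤n)) (≡ᵇ-true (f∘g d d≥1 d≤n)) ⟩
    𝟙 ((g c <ᵇ g d) ∧ true)      ≡⟨ cong 𝟙 (∧-identityʳ _) ⟩
    𝟙 (g c <ᵇ g d)               ∎
    where
    open ≡-Reasoning
    gc≥1 = proj₁ (g-range c c≥1 c≤n)
    gc≤n = proj₂ (g-range c c≥1 c≤n)
    gd≥1 = proj₁ (g-range d d≥1 d≤n)
    gd≤n = proj₂ (g-range d d≥1 d≤n)
    off-row : ∀ {i} → 1 ≤ i → i ≤ n → i ≢ g c → ∀ j → pairAt f c d i j ≡ 0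
    off-row {i} i≥1 i≤n i≢gc j rewrite ≡ᵇ-off i≥1 i≤n i≢gc | ∧-zeroʳ (i <ᵇ j) = refl
    off-column : ∀ i {j} → 1 ≤ j → j ≤ n → j ≢ g d → pairAt f c d i j ≡ 0
    off-column i {j} j≥1 j≤n j≢gd
      rewrite ≡ᵇ-off j≥1 j≤n j≢gd | ∧-zeroʳ (f i ≡ᵇ c) | ∧-zeroʳ (i <ᵇ j) = refl

  inv-s-swap : ∀ {a} → 1 ≤ a → suc a ≤ n →
               inv n (s a ∘ f) + 𝟙 (g (suc a) <ᵇ g a) ≡ inv n f + 𝟙 (g a <ᵇ g (suc a))
  inv-s-swap {a} a≥1 a<n = begin
    inv n (s a ∘ f) + 𝟙 (g (suc a) <ᵇ g a)
      ≡⟨ cong₂ _+_ (inv≡sumTo² n (s a ∘ f)) (sym (pairAt-count (s≤s z≤n) a<n a≥1 (<⇒≤ a<n))) ⟩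
    sumTo² n (inversion (s a ∘ f)) + sumTo² n (pairAt f (suc a) a)
      ≡⟨ sumTo²-distrib-+ n _ _ ⟨
    sumTo² n (λ i j → inversion (s a ∘ f) i j + pairAt f (suc a) a i j)
      ≡⟨ sumTo²-cong n (λ i j _ _ _ _ → guarded (i <ᵇ j) (s-inversion a (f i) (f j))) ⟩
    sumTo² n (λ i j → inversion f i j + pairAt f a (suc a) i j)
      ≡⟨ sumTo²-distrib-+ n _ _ ⟩
    sumTo² n (inversion f) + sumTo² n (pairAt f a (suc a))
      ≡⟨ cong₂ _+_ (sym (inv≡sumTo² n f)) (pairAt-count a≥1 (<⇒≤ a<n) (s≤s z≤n) a<n) ⟩
    inv n f + 𝟙 (g a <ᵇ g (suc a)) ∎
    where
    open ≡-Reasoning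
    guarded : ∀ b {x y z w} → 𝟙 x + 𝟙 y ≡ 𝟙 z + 𝟙 w → 𝟙 (b ∧ x) + 𝟙 (b ∧ y) ≡ 𝟙 (b ∧ z) + 𝟙 (b ∧ w)
    guarded false _  = refl
    guarded true  eq = eq

  inv-s-descent : ∀ {a} → 1 ≤ a → suc a ≤ n → g (suc a) < g a → inv n f ≡ suc (inv n (s a ∘ f))
  inv-s-descent {a} a≥1 a<n descent = begin
    inv n f                                ≡⟨ +-identityʳ _ ⟨
    inv n f + 𝟙 false                      ≡⟨ cong (λ b → inv n f + 𝟙 b) (<ᵇ-false (<-asym descent)) ⟨
    inv n f + 𝟙 (g a <ᵇ g (suc a))         ≡⟨ inv-s-swap a≥1 a<n ⟨
    inv n (s a ∘ f) + 𝟙 (g (suc a) <ᵇ g a) ≡⟨ cong (λ b → inv n (s a ∘ f) + 𝟙 b) (<ᵇ-true descent) ⟩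
    inv n (s a ∘ f) + 1                    ≡⟨ +-comm _ 1 ⟩
    suc (inv n (s a ∘ f))                  ∎
    where open ≡-Reasoning

  inv-s-ascent : ∀ {a} → 1 ≤ a → suc a ≤ n → g a < g (suc a) → inv n (s a ∘ f) ≡ suc (inv n f)
  inv-s-ascent {a} a≥1 a<n ascent = begin
    inv n (s a ∘ f)                        ≡⟨ +-identityʳ _ ⟨
    inv n (s a ∘ f) + 𝟙 false              ≡⟨ cong (λ b → inv n (s a ∘ f) + 𝟙 b) (<ᵇ-false (<-asym ascent)) ⟨
    inv n (s a ∘ f) + 𝟙 (g (suc a) <ᵇ g a) ≡⟨ inv-s-swap a≥1 a<n ⟩
    inv n f + 𝟙 (g a <ᵇ g (suc a))         ≡⟨ cong (λ b → inv n f + 𝟙 b) (<ᵇ-true ascent) ⟩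
    inv n f + 1                            ≡⟨ +-comm _ 1 ⟩
    suc (inv n f)                          ∎
    where open ≡-Reasoning

  inv-s-≤ : ∀ {a} → 1 ≤ a → suc a ≤ n → inv n (s a ∘ f) ≤ suc (inv n f)
  inv-s-≤ {a} a≥1 a<n = begin
    inv n (s a ∘ f)                        ≤⟨ m≤m+n _ _ ⟩
    inv n (s a ∘ f) + 𝟙 (g (suc a) <ᵇ g a) ≡⟨ inv-s-swap a≥1 a<n ⟩
    inv n f + 𝟙 (g a <ᵇ g (suc a))         ≤⟨ +-monoʳ-≤ (inv n f) (𝟙≤1 (g a <ᵇ g (suc a))) ⟩
    inv n f + 1                            ≡⟨ +-comm _ 1 ⟩
    suc (inv n f)                          ∎
    where
    open ≤-Reasoning
    𝟙≤1 : ∀ b → 𝟙 b ≤ 1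
    𝟙≤1 false = z≤n
    𝟙≤1 true  = ≤-refl

reflect-<ᵇ : ∀ {n i j} → i ≤ suc n → j ≤ suc n → (suc n ∸ i <ᵇ suc n ∸ j) ≡ (j <ᵇ i)
reflect-<ᵇ {n} {i} {j} i≤1+n j≤1+n with j <? i
... | yes j<i = trans (<ᵇ-true (∸-monoʳ-< j<i i≤1+n)) (sym (<ᵇ-true j<i))
... | no j≮i  = trans (<ᵇ-false (≤⇒≯ (∸-monoʳ-≤ (suc n) (≮⇒≥ j≮i)))) (sym (<ᵇ-false j≮i))

inv-reflect : ∀ n f → inv n (λ i → f (suc n ∸ i)) ≡ sumTo² n (λ i j → 𝟙 ((i <ᵇ j) ∧ (f i <ᵇ f j)))
inv-reflect n f = begin
  inv n (f ∘ R)                                                 ≡⟨ inv≡sumTo² n (f ∘ R) ⟩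
  sumTo² n (inversion (f ∘ R))                                  ≡⟨ sumTo-reflect n _ ⟩
  sumTo n (λ i → sumTo n (inversion (f ∘ R) (R i)))             ≡⟨ sumTo-cong n (λ i _ _ → sumTo-reflect n _) ⟩
  sumTo² n (λ i j → inversion (f ∘ R) (R i) (R j))              ≡⟨ sumTo²-cong n reflected ⟩
  sumTo² n (λ i j → 𝟙 ((j <ᵇ i) ∧ (f j <ᵇ f i)))                ≡⟨ sumTo-comm n n _ ⟩
  sumTo² n (λ i j → 𝟙 ((i <ᵇ j) ∧ (f i <ᵇ f j)))                ∎
  where
  open ≡-Reasoning
  R : ℕ → ℕ
  R i = suc n ∸ i
  reflected : ∀ i j → 1 ≤ i → i ≤ n → 1 ≤ j → j ≤ n →
              inversion (f ∘ R) (R i) (R j) ≡ 𝟙 ((j <ᵇ i) ∧ (f j <ᵇ f i))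
  reflected i j _ i≤n _ j≤n
    rewrite m∸[m∸n]≡n (m≤n⇒m≤1+n i≤n) | m∸[m∸n]≡n (m≤n⇒m≤1+n j≤n)
          | reflect-<ᵇ {n} (m≤n⇒m≤1+n i≤n) (m≤n⇒m≤1+n j≤n) = refl

inv-reverse : ∀ {n f g} → InverseOn n f g → inv n f + inv n (λ i → f (suc n ∸ i)) ≡ triangle n
inv-reverse {n} {f} inverse = begin
  inv n f + inv n (λ i → f (suc n ∸ i))
    ≡⟨ cong₂ _+_ (inv≡sumTo² n f) (inv-reflect n f) ⟩
  sumTo² n (inversion f) + sumTo² n (λ i j → 𝟙 ((i <ᵇ j) ∧ (f i <ᵇ f j)))
    ≡⟨ sumTo²-distrib-+ n _ _ ⟨
  sumTo² n (λ i j → inversion f i j + 𝟙 ((i <ᵇ j) ∧ (f i <ᵇ f j)))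
    ≡⟨ sumTo²-cong n complementary ⟩
  sumTo² n (λ i j → 𝟙 (i <ᵇ j))
    ≡⟨ pairs-triangle n ⟩
  triangle n ∎
  where
  open ≡-Reasoning
  open InverseOn inverse using (f-injective)
  complementary : ∀ i j → 1 ≤ i → i ≤ n → 1 ≤ j → j ≤ n →
                  inversion f i j + 𝟙 ((i <ᵇ j) ∧ (f i <ᵇ f j)) ≡ 𝟙 (i <ᵇ j)
  complementary i j i≥1 i≤n j≥1 j≤n with i <? j
  ... | no i≮j rewrite <ᵇ-false i≮j = refl
  ... | yes i<j rewrite <ᵇ-true i<j with f j <? f i
  ...   | yes fj<fi rewrite <ᵇ-true fj<fi | <ᵇ-false (<-asym fj<fi) = refl
  ...   | no fj≮fi  rewrite <ᵇ-false fj≮fi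
                          | <ᵇ-true (≤∧≢⇒< (≮⇒≥ fj≮fi) (<⇒≢ i<j ∘ f-injective i≥1 i≤n j≥1 j≤n)) = refl


-- Counting reduced words

≤∸1⇒< : ∀ {a n} → 1 ≤ a → a ≤ n ∸ 1 → suc a ≤ n
≤∸1⇒< {n = zero}  a≥1 a≤0 = contradiction a≤0 (<⇒≱ a≥1)
≤∸1⇒< {n = suc n} _   a≤n = s≤s a≤n

<⇒≤∸1 : ∀ {a n} → suc a ≤ n → a ≤ n ∸ 1
<⇒≤∸1 (s≤s a≤n) = a≤n

∈-range⁺ : ∀ {n i} → 1 ≤ i → i ≤ n → i ∈ range n
∈-range⁺ {i = suc i} _ i<n = ∈-map⁺ suc (∈-upTo⁺ i<n)

∈-range⁻ : ∀ {n i} → i ∈ range n → 1 ≤ i × i ≤ n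
∈-range⁻ i∈ with _ , k∈ , refl ← ∈-map⁻ suc i∈ = s≤s z≤n , ∈-upTo⁻ k∈

All-range⁺ : ∀ {n} {P : ℕ → Set} → (∀ i → 1 ≤ i → i ≤ n → P i) → All P (range n)
All-range⁺ Pi = All.tabulate λ i∈ → let (i≥1 , i≤n) = ∈-range⁻ i∈ in Pi _ i≥1 i≤n

All-range⁻ : ∀ {n} {P : ℕ → Set} → All P (range n) → ∀ i → 1 ≤ i → i ≤ n → P i
All-range⁻ all i i≥1 i≤n = All.lookup all (∈-range⁺ i≥1 i≤n)

represents-cong : ∀ {n w w′} → AgreeOn n w w′ → Represents n w ⊆ Represents n w′
represents-cong w≗w′ rep = All-range⁺ λ i i≥1 i≤n → trans (All-range⁻ rep i i≥1 i≤n) (w≗w′ i i≥1 i≤n)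

repCount : ℕ → ℕ → (ℕ → ℕ) → ℕ
repCount n p w = length (filter (represents? n w) (words p (range (n ∸ 1))))

repCount-cong : ∀ n p {w w′} → AgreeOn n w w′ → repCount n p w ≡ repCount n p w′
repCount-cong n p {w} {w′} w≗w′ = cong length (filter-≐ (represents? n w) (represents? n w′)
  ((λ {ws} → represents-cong w≗w′ {ws}) , λ {ws} → represents-cong (λ i i≥1 i≤n → sym (w≗w′ i i≥1 i≤n)) {ws})
  (words p (range (n ∸ 1))))

redWords-cong : ∀ n {w w′} → AgreeOn n w w′ → redWords n w ≡ redWords n w′
redWords-cong n {w} {w′} w≗w′ =
  trans (cong (λ p → repCount n p w) (inv-cong n w≗w′)) (repCount-cong n (inv n w′) w≗w′)

repCount-id : ∀ n {w} → AgreeOn n id w → repCount n 0 w ≡ 1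
repCount-id n id≗w = cong length (filter-accept (represents? n _) (All-range⁺ id≗w))

redWords-id : ∀ n {w} → AgreeOn n id w → redWords n w ≡ 1
redWords-id n {w} id≗w = trans (cong (λ p → repCount n p w) (trans (sym (inv-cong n id≗w)) (inv-id n)))
                                (repCount-id n id≗w)

length-filter-map : ∀ {A B : Set} {P : B → Set} (P? : Decidable P) (f : A → B) xs →
                    length (filter P? (map f xs)) ≡ length (filter (P? ∘ f) xs)
length-filter-map P? f []       = refl
length-filter-map P? f (x ∷ xs) with does (P? (f x))
... | true  = cong suc (length-filter-map P? f xs)
... | false = length-filter-map P? f xs

represents-∷ : ∀ n w a → Represents n w ∘ (a ∷_) ≐ Represents n (s a ∘ w)
represents-∷ n w a = All.map (λ {i} eq → trans (sym (s-involutive a _)) (cong (s a) eq))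
                   , All.map (λ {i} eq → trans (cong (s a) eq) (s-involutive a _))

-- Splitting off the first letter a of a word representing w leaves a word representing s_a w.
repCount-suc : ∀ n p w → repCount n (suc p) w ≡ sumTo (n ∸ 1) (λ a → repCount n p (s a ∘ w))
repCount-suc n p w = trans (by-first-letter (range (n ∸ 1))) (sum-map-range (n ∸ 1) _)
  where
  shorter = words p (range (n ∸ 1))
  by-first-letter : ∀ as → length (filter (represents? n w) (concatMap (λ a → map (a ∷_) shorter) as))
                         ≡ sum (map (λ a → repCount n p (s a ∘ w)) as)
  by-first-letter []       = refl
  by-first-letter (a ∷ as) = begin
    length (filter (represents? n w) (map (a ∷_) shorter ++ concatMap (λ a → map (a ∷_) shorter) as))
      ≡⟨ cong length (filter-++ (represents? n w) (map (a ∷_) shorter) _) ⟩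
    length (filter (represents? n w) (map (a ∷_) shorter) ++ filter (represents? n w) (concatMap _ as))
      ≡⟨ length-++ (filter (represents? n w) (map (a ∷_) shorter)) ⟩
    length (filter (represents? n w) (map (a ∷_) shorter)) + length (filter (represents? n w) (concatMap _ as))
      ≡⟨ cong₂ _+_ (trans (length-filter-map (represents? n w) (a ∷_) shorter)
                          (cong length (filter-≐ _ (represents? n (s a ∘ w)) (represents-∷ n w a) shorter)))
                   (by-first-letter as) ⟩
    repCount n p (s a ∘ w) + sum (map (λ a → repCount n p (s a ∘ w)) as) ∎
    where open ≡-Reasoning

words-shape : ∀ p as → All (λ ws → length ws ≡ p × All (_∈ as) ws) (words p as)
words-shape zero    as = (refl , []) ∷ []
words-shape (suc p) as = by-first-letter as (All.tabulate id)
  where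
  by-first-letter : ∀ bs → All (_∈ as) bs → All (λ ws → length ws ≡ suc p × All (_∈ as) ws)
                                                 (concatMap (λ a → map (a ∷_) (words p as)) bs)
  by-first-letter []       []            = []
  by-first-letter (b ∷ bs) (b∈as ∷ bs⊆as) =
    ++⁺ (map⁺ (All.map (λ (len , letters) → cong suc len , b∈as ∷ letters) (words-shape p as)))
        (by-first-letter bs bs⊆as)

wordPerm-inverse : ∀ {n} ws → All (_∈ range (n ∸ 1)) ws → ∃[ g ] InverseOn n (wordPerm ws) g
wordPerm-inverse {n} []       []               = id , InverseOn-id n
wordPerm-inverse {n} (a ∷ ws) (a∈ ∷ letters) =
  let (g , inverse) = wordPerm-inverse {n} ws letters
      (a≥1 , a≤n-1) = ∈-range⁻ a∈
  in g ∘ s a , InverseOn-s∘ a≥1 (≤∸1⇒< a≥1 a≤n-1) inverse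

inv-wordPerm-≤ : ∀ {n} ws → All (_∈ range (n ∸ 1)) ws → inv n (wordPerm ws) ≤ length ws
inv-wordPerm-≤ {n} []       []               = ≤-reflexive (inv-id n)
inv-wordPerm-≤ {n} (a ∷ ws) (a∈ ∷ letters) =
  let (a≥1 , a≤n-1) = ∈-range⁻ a∈
  in ≤-trans (inv-s-≤ (proj₂ (wordPerm-inverse {n} ws letters)) a≥1 (≤∸1⇒< a≥1 a≤n-1))
             (s≤s (inv-wordPerm-≤ {n} ws letters))

repCount-zero : ∀ n p w → p < inv n w → repCount n p w ≡ 0
repCount-zero n p w p<inv =
  cong length (filter-none (represents? n w) (All.map too-short (words-shape p (range (n ∸ 1)))))
  where
  too-short : ∀ {ws} → length ws ≡ p × All (_∈ range (n ∸ 1)) ws → ¬ Represents n w ws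
  too-short {ws} (len , letters) rep = <⇒≱ p<inv (begin
    inv n w              ≡⟨ inv-cong n (All-range⁻ rep) ⟨
    inv n (wordPerm ws)  ≤⟨ inv-wordPerm-≤ {n} ws letters ⟩
    length ws            ≡⟨ len ⟩
    p                    ∎)
    where open ≤-Reasoning

module _ {n f g} (inverse : InverseOn n f g) where
  open InverseOn inverse

  private
    descent-or-ascent : ∀ {a} → 1 ≤ a → suc a ≤ n → ¬ g (suc a) < g a → g a < g (suc a)
    descent-or-ascent {a} a≥1 a<n not-descent = ≤∧≢⇒< (≮⇒≥ not-descent) λ ga≡ga+1 →
      1+n≢n (sym (trans (sym (f∘g a a≥1 (<⇒≤ a<n))) (trans (cong f ga≡ga+1) (f∘g (suc a) (s≤s z≤n) a<n))))

    ascent-term : ∀ {a} → g a < g (suc a) → 𝟙 (g (suc a) <ᵇ g a) * redWords n (s a ∘ f) ≡ 0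
    ascent-term ascent rewrite <ᵇ-false (<-asym ascent) = refl

    descent-term : ∀ {a} → g (suc a) < g a →
                   𝟙 (g (suc a) <ᵇ g a) * redWords n (s a ∘ f) ≡ redWords n (s a ∘ f)
    descent-term descent rewrite <ᵇ-true descent = +-identityʳ _

  redWords-descents : ∀ {d} → 1 ≤ d → suc d ≤ n → g (suc d) < g d →
    redWords n f ≡ sumTo (n ∸ 1) (λ a → 𝟙 (g (suc a) <ᵇ g a) * redWords n (s a ∘ f))
  redWords-descents {d} d≥1 d<n d-descent = begin
    repCount n (inv n f) f                           ≡⟨ cong (λ p → repCount n p f) inv-f ⟩
    repCount n (suc m) f                             ≡⟨ repCount-suc n m f ⟩
    sumTo (n ∸ 1) (λ a → repCount n m (s a ∘ f))     ≡⟨ sumTo-cong (n ∸ 1) term ⟩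
    sumTo (n ∸ 1) (λ a → 𝟙 (g (suc a) <ᵇ g a) * redWords n (s a ∘ f)) ∎
    where
    open ≡-Reasoning
    m = inv n (s d ∘ f)
    inv-f : inv n f ≡ suc m
    inv-f = inv-s-descent inverse d≥1 d<n d-descent
    term : ∀ a → 1 ≤ a → a ≤ n ∸ 1 → repCount n m (s a ∘ f) ≡ 𝟙 (g (suc a) <ᵇ g a) * redWords n (s a ∘ f)
    term a a≥1 a≤n-1 with g (suc a) <? g a
    ... | yes a-descent = trans (cong (λ p → repCount n p (s a ∘ f)) m≡inv) (sym (descent-term a-descent))
      where
      m≡inv : m ≡ inv n (s a ∘ f)
      m≡inv = suc-injective (trans (sym inv-f) (inv-s-descent inverse a≥1 (≤∸1⇒< a≥1 a≤n-1) a-descent))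
    ... | no not-descent = trans (repCount-zero n m (s a ∘ f) m<inv) (sym (ascent-term ascent))
      where
      a<n = ≤∸1⇒< a≥1 a≤n-1
      ascent = descent-or-ascent a≥1 a<n not-descent
      m<inv : m < inv n (s a ∘ f)
      m<inv = subst (m <_) (sym (trans (inv-s-ascent inverse a≥1 a<n ascent) (cong suc inv-f)))
                    (<-trans (n<1+n m) (n<1+n (suc m)))

  redWords-one-descent : ∀ {d} → 1 ≤ d → suc d ≤ n → g (suc d) < g d →
    (∀ a → 1 ≤ a → suc a ≤ n → a ≢ d → g a < g (suc a)) → redWords n f ≡ redWords n (s d ∘ f)
  redWords-one-descent {d} d≥1 d<n d-descent ascents = begin
    redWords n f
      ≡⟨ redWords-descents d≥1 d<n d-descent ⟩
    sumTo (n ∸ 1) (λ a → 𝟙 (g (suc a) <ᵇ g a) * redWords n (s a ∘ f))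
      ≡⟨ sumTo-support₁ (n ∸ 1) d d≥1 (<⇒≤∸1 d<n) (λ a a≥1 a≤n-1 a≢d →
           ascent-term (ascents a a≥1 (≤∸1⇒< a≥1 a≤n-1) a≢d)) ⟩
    𝟙 (g (suc d) <ᵇ g d) * redWords n (s d ∘ f)
      ≡⟨ descent-term d-descent ⟩
    redWords n (s d ∘ f) ∎
    where open ≡-Reasoning

  redWords-two-descents : ∀ {d d′} → 1 ≤ d → suc d ≤ n → g (suc d) < g d →
    1 ≤ d′ → suc d′ ≤ n → g (suc d′) < g d′ → d ≢ d′ →
    (∀ a → 1 ≤ a → suc a ≤ n → a ≢ d → a ≢ d′ → g a < g (suc a)) →
    redWords n f ≡ redWords n (s d ∘ f) + redWords n (s d′ ∘ f)
  redWords-two-descents {d} {d′} d≥1 d<n d-descent d′≥1 d′<n d′-descent d≢d′ ascents = begin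
    redWords n f
      ≡⟨ redWords-descents d≥1 d<n d-descent ⟩
    sumTo (n ∸ 1) (λ a → 𝟙 (g (suc a) <ᵇ g a) * redWords n (s a ∘ f))
      ≡⟨ sumTo-support₂ (n ∸ 1) d d′ d≥1 (<⇒≤∸1 d<n) d′≥1 (<⇒≤∸1 d′<n) d≢d′ (λ a a≥1 a≤n-1 a≢d a≢d′ →
           ascent-term (ascents a a≥1 (≤∸1⇒< a≥1 a≤n-1) a≢d a≢d′)) ⟩
    𝟙 (g (suc d) <ᵇ g d) * redWords n (s d ∘ f) + 𝟙 (g (suc d′) <ᵇ g d′) * redWords n (s d′ ∘ f)
      ≡⟨ cong₂ _+_ (descent-term d-descent) (descent-term d′-descent) ⟩
    redWords n (s d ∘ f) + redWords n (s d′ ∘ f) ∎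
    where open ≡-Reasoning


-- The permutations [x, …, y] with increasing middle entries

-- middle lo hi maps the positions 2, …, n-1 increasingly onto {1, …, n} ∖ {lo, hi}.
middle : ℕ → ℕ → ℕ → ℕ
middle lo hi i = if i ≤ᵇ lo then i ∸ 1 else if i <ᵇ hi then i else suc i

middle⁻¹ : ℕ → ℕ → ℕ → ℕ
middle⁻¹ lo hi k = if k <ᵇ lo then suc k else if k <ᵇ hi then k else k ∸ 1

module _ {lo hi : ℕ} where
  middle-≤lo : ∀ {i} → i ≤ lo → middle lo hi i ≡ i ∸ 1
  middle-≤lo i≤lo rewrite ≤ᵇ-true i≤lo = refl

  middle-between : ∀ {i} → lo < i → i < hi → middle lo hi i ≡ i
  middle-between lo<i i<hi rewrite ≤ᵇ-false (<⇒≱ lo<i) | <ᵇ-true i<hi = refl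

  middle-≥hi : ∀ {i} → lo < i → hi ≤ i → middle lo hi i ≡ suc i
  middle-≥hi lo<i hi≤i rewrite ≤ᵇ-false (<⇒≱ lo<i) | <ᵇ-false (≤⇒≯ hi≤i) = refl

  middle⁻¹-<lo : ∀ {k} → k < lo → middle⁻¹ lo hi k ≡ suc k
  middle⁻¹-<lo k<lo rewrite <ᵇ-true k<lo = refl

  middle⁻¹-between : ∀ {k} → lo ≤ k → k < hi → middle⁻¹ lo hi k ≡ k
  middle⁻¹-between lo≤k k<hi rewrite <ᵇ-false (≤⇒≯ lo≤k) | <ᵇ-true k<hi = refl

  middle⁻¹-≥hi : ∀ {k} → lo ≤ k → hi ≤ k → middle⁻¹ lo hi k ≡ k ∸ 1
  middle⁻¹-≥hi lo≤k hi≤k rewrite <ᵇ-false (≤⇒≯ lo≤k) | <ᵇ-false (≤⇒≯ hi≤k) = refl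

≤⇒∸1< : ∀ {i m} → 1 ≤ m → i ≤ m → i ∸ 1 < m
≤⇒∸1< {zero}  m≥1 _   = m≥1
≤⇒∸1< {suc i} _   i<m = i<m

module _ {lo hi : ℕ} (lo≥1 : 1 ≤ lo) (lo<hi : lo < hi) where

  middle-avoids : ∀ i → middle lo hi i ≢ lo × middle lo hi i ≢ hi
  middle-avoids i with i ≤? lo
  ... | yes i≤lo rewrite middle-≤lo {lo} {hi} i≤lo =
          <⇒≢ (≤⇒∸1< lo≥1 i≤lo) , <⇒≢ (<-trans (≤⇒∸1< lo≥1 i≤lo) lo<hi)
  ... | no i≰lo with i <? hi
  ...   | yes i<hi rewrite middle-between {lo} {hi} (≰⇒> i≰lo) i<hi = <⇒≢ (≰⇒> i≰lo) ∘ sym , <⇒≢ i<hi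
  ...   | no i≮hi rewrite middle-≥hi {lo} {hi} (≰⇒> i≰lo) (≮⇒≥ i≮hi) =
            <⇒≢ (<-trans (≰⇒> i≰lo) (n<1+n i)) ∘ sym , <⇒≢ (s≤s (≮⇒≥ i≮hi)) ∘ sym

  middle⁻¹-inner : ∀ {n k} → hi ≤ n → 1 ≤ k → k ≤ n → k ≢ lo → k ≢ hi →
                   1 < middle⁻¹ lo hi k × middle⁻¹ lo hi k < n × middle lo hi (middle⁻¹ lo hi k) ≡ k
  middle⁻¹-inner {n} {k} hi≤n k≥1 k≤n k≢lo k≢hi with k <? lo
  ... | yes k<lo rewrite middle⁻¹-<lo {lo} {hi} k<lo | middle-≤lo {lo} {hi} k<lo =
          s≤s k≥1 , <-≤-trans (≤-<-trans k<lo lo<hi) hi≤n , refl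
  ... | no k≮lo with k <? hi
  ...   | yes k<hi rewrite middle⁻¹-between {lo} {hi} (≮⇒≥ k≮lo) k<hi
                         | middle-between {lo} {hi} (≤∧≢⇒< (≮⇒≥ k≮lo) (k≢lo ∘ sym)) k<hi =
            <-≤-trans (s≤s lo≥1) (≤∧≢⇒< (≮⇒≥ k≮lo) (k≢lo ∘ sym)) , <-≤-trans k<hi hi≤n , refl
  middle⁻¹-inner {n} {suc k} hi≤n k≥1 k<n k≢lo k≢hi | no k≮lo | no k≮hi
    rewrite middle⁻¹-≥hi {lo} {hi} (≮⇒≥ k≮lo) (≮⇒≥ k≮hi) =
      <-≤-trans (s≤s lo≥1) (<-≤-trans lo<hi hi≤k) , k<n , middle-≥hi {lo} {hi} (<-≤-trans lo<hi hi≤k) hi≤k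
    where hi≤k = ≤-pred (≤∧≢⇒< (≮⇒≥ k≮hi) (k≢hi ∘ sym))

  middle⁻¹∘middle : ∀ {i} → 1 < i → middle⁻¹ lo hi (middle lo hi i) ≡ i
  middle⁻¹∘middle {suc i} _ with suc i ≤? lo
  ... | yes i<lo rewrite middle-≤lo {lo} {hi} i<lo | middle⁻¹-<lo {lo} {hi} i<lo = refl
  ... | no i≮lo with suc i <? hi
  ...   | yes i<hi rewrite middle-between {lo} {hi} (≰⇒> i≮lo) i<hi
                         | middle⁻¹-between {lo} {hi} (<⇒≤ (≰⇒> i≮lo)) i<hi = refl
  ...   | no i≮hi rewrite middle-≥hi {lo} {hi} (≰⇒> i≮lo) (≮⇒≥ i≮hi)
                        | middle⁻¹-≥hi {lo} {hi} (≤-trans (<⇒≤ (≰⇒> i≮lo)) (n≤1+n _))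
                                                 (≤-trans (≮⇒≥ i≮hi) (n≤1+n _)) = refl

  middle⁻¹-mono : ∀ {a} → a ≢ lo → a ≢ hi → suc a ≢ lo → suc a ≢ hi →
                  middle⁻¹ lo hi a < middle⁻¹ lo hi (suc a)
  middle⁻¹-mono {a} a≢lo a≢hi a+1≢lo a+1≢hi with a <? lo
  ... | yes a<lo rewrite middle⁻¹-<lo {lo} {hi} a<lo | middle⁻¹-<lo {lo} {hi} (≤∧≢⇒< a<lo a+1≢lo) = ≤-refl
  ... | no a≮lo with a <? hi
  ...   | yes a<hi rewrite middle⁻¹-between {lo} {hi} (≮⇒≥ a≮lo) a<hi
                         | middle⁻¹-between {lo} {hi} (≤-trans (≮⇒≥ a≮lo) (n≤1+n a)) (≤∧≢⇒< a<hi a+1≢hi)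
      = ≤-refl
  middle⁻¹-mono {suc a} _ _ _ _ | no a≮lo | no a≮hi
    rewrite middle⁻¹-≥hi {lo} {hi} (≮⇒≥ a≮lo) (≮⇒≥ a≮hi)
          | middle⁻¹-≥hi {lo} {hi} (≤-trans (≮⇒≥ a≮lo) (n≤1+n _)) (≤-trans (≮⇒≥ a≮hi) (n≤1+n _)) = ≤-refl
  middle⁻¹-mono {zero} _ 0≢hi _ _ | no _ | no 0≮hi = contradiction (sym (n≤0⇒n≡0 (≮⇒≥ 0≮hi))) 0≢hi

-- framed n x y lo hi = [x, middle lo hi 2, …, middle lo hi (n-1), y], where {lo, hi} = {x, y}.
framed : ℕ → ℕ → ℕ → ℕ → ℕ → ℕ → ℕ
framed n x y lo hi i = if i ≡ᵇ 1 then x else if i ≡ᵇ n then y else middle lo hi i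

framed⁻¹ : ℕ → ℕ → ℕ → ℕ → ℕ → ℕ → ℕ
framed⁻¹ n x y lo hi k = if k ≡ᵇ x then 1 else if k ≡ᵇ y then n else middle⁻¹ lo hi k

record Frame (n x y lo hi : ℕ) : Set where
  field
    lo≥1  : 1 ≤ lo
    lo<hi : lo < hi
    hi≤n  : hi ≤ n
    ends  : (x ≡ lo × y ≡ hi) ⊎ (x ≡ hi × y ≡ lo)

  n>1 : 1 < n
  n>1 = <-≤-trans (≤-<-trans lo≥1 lo<hi) hi≤n

  x≢y : x ≢ y
  x≢y with ends
  ... | inj₁ (refl , refl) = <⇒≢ lo<hi
  ... | inj₂ (refl , refl) = <⇒≢ lo<hi ∘ sym

  ≢ends : ∀ {k} → k ≢ lo → k ≢ hi → k ≢ x × k ≢ y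
  ≢ends k≢lo k≢hi with ends
  ... | inj₁ (refl , refl) = k≢lo , k≢hi
  ... | inj₂ (refl , refl) = k≢hi , k≢lo

  ≢lo-hi : ∀ {k} → k ≢ x → k ≢ y → k ≢ lo × k ≢ hi
  ≢lo-hi k≢x k≢y with ends
  ... | inj₁ (refl , refl) = k≢x , k≢y
  ... | inj₂ (refl , refl) = k≢y , k≢x

  x≤n : x ≤ n
  x≤n with ends
  ... | inj₁ (refl , refl) = ≤-trans (<⇒≤ lo<hi) hi≤n
  ... | inj₂ (refl , refl) = hi≤n

  y≥1 : 1 ≤ y
  y≥1 with ends
  ... | inj₁ (refl , refl) = ≤-trans lo≥1 (<⇒≤ lo<hi)
  ... | inj₂ (refl , refl) = lo≥1

frame-increasing : ∀ {n x y} → 1 ≤ x → x < y → y ≤ n → Frame n x y x y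
frame-increasing x≥1 x<y y≤n = record { lo≥1 = x≥1 ; lo<hi = x<y ; hi≤n = y≤n ; ends = inj₁ (refl , refl) }

frame-decreasing : ∀ {n x y} → 1 ≤ y → y < x → x ≤ n → Frame n x y y x
frame-decreasing y≥1 y<x x≤n = record { lo≥1 = y≥1 ; lo<hi = y<x ; hi≤n = x≤n ; ends = inj₂ (refl , refl) }

module FramedValues (n x y lo hi : ℕ) where
  framed-last : 1 < n → framed n x y lo hi n ≡ y
  framed-last n>1 rewrite ≡ᵇ-false (<⇒≢ n>1 ∘ sym) | ≡ᵇ-true (refl {x = n}) = refl

  framed-inner : ∀ {i} → i ≢ 1 → i ≢ n → framed n x y lo hi i ≡ middle lo hi i
  framed-inner i≢1 i≢n rewrite ≡ᵇ-false i≢1 | ≡ᵇ-false i≢n = refl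

  framed⁻¹-first : framed⁻¹ n x y lo hi x ≡ 1
  framed⁻¹-first rewrite ≡ᵇ-true (refl {x = x}) = refl

  framed⁻¹-last : x ≢ y → framed⁻¹ n x y lo hi y ≡ n
  framed⁻¹-last x≢y rewrite ≡ᵇ-false (x≢y ∘ sym) | ≡ᵇ-true (refl {x = y}) = refl

  framed⁻¹-inner : ∀ {k} → k ≢ x → k ≢ y → framed⁻¹ n x y lo hi k ≡ middle⁻¹ lo hi k
  framed⁻¹-inner k≢x k≢y rewrite ≡ᵇ-false k≢x | ≡ᵇ-false k≢y = refl

module _ {n x y lo hi : ℕ} (frame : Frame n x y lo hi) where
  open Frame frame
  open FramedValues n x y lo hi

  private
    F = framed n x y lo hi
    F⁻¹ = framed⁻¹ n x y lo hi

    middle⁻¹-inside : ∀ {k} → 1 ≤ k → k ≤ n → k ≢ x → k ≢ y → 1 < middle⁻¹ lo hi k × middle⁻¹ lo hi k < n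
    middle⁻¹-inside k≥1 k≤n k≢x k≢y =
      let (k≢lo , k≢hi) = ≢lo-hi k≢x k≢y
          (>1 , <n , _) = middle⁻¹-inner lo≥1 lo<hi hi≤n k≥1 k≤n k≢lo k≢hi
      in >1 , <n

  framed-inverse : InverseOn n F F⁻¹
  framed-inverse = record { g-range = F⁻¹-range ; f∘g = F∘F⁻¹ ; g∘f = F⁻¹∘F }
    where
    F⁻¹-range : ∀ k → 1 ≤ k → k ≤ n → 1 ≤ F⁻¹ k × F⁻¹ k ≤ n
    F⁻¹-range k k≥1 k≤n with k ≟ x | k ≟ y
    ... | yes refl | _        rewrite framed⁻¹-first = ≤-refl , <⇒≤ n>1
    ... | no _     | yes refl rewrite framed⁻¹-last x≢y = <⇒≤ n>1 , ≤-refl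
    ... | no k≢x   | no k≢y   rewrite framed⁻¹-inner k≢x k≢y =
            let (>1 , <n) = middle⁻¹-inside k≥1 k≤n k≢x k≢y in <⇒≤ >1 , <⇒≤ <n
    F∘F⁻¹ : ∀ k → 1 ≤ k → k ≤ n → F (F⁻¹ k) ≡ k
    F∘F⁻¹ k k≥1 k≤n with k ≟ x | k ≟ y
    ... | yes refl | _        rewrite framed⁻¹-first = refl
    ... | no _     | yes refl rewrite framed⁻¹-last x≢y = framed-last n>1
    ... | no k≢x   | no k≢y   rewrite framed⁻¹-inner k≢x k≢y =
            let (k≢lo , k≢hi) = ≢lo-hi k≢x k≢y
                (>1 , <n , middle∘middle⁻¹) = middle⁻¹-inner lo≥1 lo<hi hi≤n k≥1 k≤n k≢lo k≢hi
            in trans (framed-inner (<⇒≢ >1 ∘ sym) (<⇒≢ <n)) middle∘middle⁻¹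
    F⁻¹∘F : ∀ i → 1 ≤ i → i ≤ n → F⁻¹ (F i) ≡ i
    F⁻¹∘F i i≥1 i≤n with i ≟ 1 | i ≟ n
    ... | yes refl | _        = framed⁻¹-first
    ... | no _     | yes refl rewrite framed-last n>1 = framed⁻¹-last x≢y
    ... | no i≢1   | no i≢n   rewrite framed-inner i≢1 i≢n =
            let (≢lo , ≢hi) = middle-avoids lo≥1 lo<hi i
                (≢x , ≢y) = ≢ends ≢lo ≢hi
            in trans (framed⁻¹-inner ≢x ≢y) (middle⁻¹∘middle lo≥1 lo<hi (≤∧≢⇒< i≥1 (i≢1 ∘ sym)))

  framed-ascent : ∀ {a} → 1 ≤ a → suc a ≤ n → suc a ≢ x → a ≢ y → F⁻¹ a < F⁻¹ (suc a)
  framed-ascent {a} a≥1 a<n a+1≢x a≢y with a ≟ x | suc a ≟ y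
  ... | yes refl | yes refl rewrite framed⁻¹-first | framed⁻¹-last x≢y
      = n>1
  ... | yes refl | no a+1≢y rewrite framed⁻¹-first | framed⁻¹-inner a+1≢x a+1≢y
      = proj₁ (middle⁻¹-inside (s≤s z≤n) a<n a+1≢x a+1≢y)
  ... | no a≢x   | yes refl rewrite framed⁻¹-inner a≢x a≢y | framed⁻¹-last x≢y
      = proj₂ (middle⁻¹-inside a≥1 (<⇒≤ a<n) a≢x a≢y)
  ... | no a≢x   | no a+1≢y rewrite framed⁻¹-inner a≢x a≢y | framed⁻¹-inner a+1≢x a+1≢y
      = let (a≢lo , a≢hi) = ≢lo-hi a≢x a≢y
            (a+1≢lo , a+1≢hi) = ≢lo-hi a+1≢x a+1≢y
        in middle⁻¹-mono lo≥1 lo<hi a≢lo a≢hi a+1≢lo a+1≢hi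

  framed-descent-first : ∀ {a} → 1 ≤ a → suc a ≡ x → F⁻¹ (suc a) < F⁻¹ a
  framed-descent-first {a} a≥1 refl with a ≟ y
  ... | yes refl rewrite framed⁻¹-first | framed⁻¹-last x≢y = n>1
  ... | no a≢y   rewrite framed⁻¹-first | framed⁻¹-inner (1+n≢n ∘ sym) a≢y
      = proj₁ (middle⁻¹-inside a≥1 (≤-trans (n≤1+n a) x≤n) (1+n≢n ∘ sym) a≢y)

  framed-descent-last : y < n → F⁻¹ (suc y) < F⁻¹ y
  framed-descent-last y<n with suc y ≟ x
  ... | yes refl rewrite framed⁻¹-first | framed⁻¹-last x≢y = n>1
  ... | no y+1≢x rewrite framed⁻¹-last x≢y | framed⁻¹-inner y+1≢x 1+n≢n
      = proj₂ (middle⁻¹-inside (s≤s z≤n) y<n y+1≢x 1+n≢n)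

framed-move : ∀ {n x y lo hi x′ y′ lo′ hi′} a → 1 < n → s a x ≡ x′ → s a y ≡ y′ →
  (∀ i → 1 < i → i < n → s a (middle lo hi i) ≡ middle lo′ hi′ i) →
  AgreeOn n (s a ∘ framed n x y lo hi) (framed n x′ y′ lo′ hi′)
framed-move {n} {x} {y} {lo} {hi} {x′} {y′} {lo′} {hi′} a n>1 first last inner i i≥1 i≤n with i ≟ 1 | i ≟ n
... | yes refl | _        = first
... | no _     | yes refl = trans (cong (s a) (FramedValues.framed-last n x y lo hi n>1))
                                  (trans last (sym (FramedValues.framed-last n x′ y′ lo′ hi′ n>1)))
... | no i≢1   | no i≢n   = trans (cong (s a) (FramedValues.framed-inner n x y lo hi i≢1 i≢n))
                                  (trans (inner i (≤∧≢⇒< i≥1 (i≢1 ∘ sym)) (≤∧≢⇒< i≤n i≢n))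
                                         (sym (FramedValues.framed-inner n x′ y′ lo′ hi′ i≢1 i≢n)))

s∘middle-lo : ∀ {lo hi} i → 1 ≤ lo → suc lo < hi → s lo (middle lo hi i) ≡ middle (suc lo) hi i
s∘middle-lo {lo} {hi} i lo≥1 lo+1<hi with i ≤? lo
... | yes i≤lo rewrite middle-≤lo {lo} {hi} i≤lo | middle-≤lo {suc lo} {hi} (m≤n⇒m≤1+n i≤lo) =
        s-fixed lo (<⇒≢ (≤⇒∸1< lo≥1 i≤lo)) (<⇒≢ (<-trans (≤⇒∸1< lo≥1 i≤lo) (n<1+n lo)))
... | no i≰lo with i ≟ suc lo
...   | yes refl rewrite middle-between {lo} {hi} (n<1+n lo) lo+1<hi
                       | middle-≤lo {suc lo} {hi} (≤-refl {suc lo})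
  = s-right lo
...   | no i≢lo+1 with i <? hi
...     | yes i<hi rewrite middle-between {lo} {hi} (≰⇒> i≰lo) i<hi
                         | middle-between {suc lo} {hi} (≤∧≢⇒< (≰⇒> i≰lo) (i≢lo+1 ∘ sym)) i<hi =
            s-fixed lo (<⇒≢ (≰⇒> i≰lo) ∘ sym) i≢lo+1
...     | no i≮hi rewrite middle-≥hi {lo} {hi} (≰⇒> i≰lo) (≮⇒≥ i≮hi)
                        | middle-≥hi {suc lo} {hi} (≤∧≢⇒< (≰⇒> i≰lo) (i≢lo+1 ∘ sym)) (≮⇒≥ i≮hi) =
            s-fixed lo (<⇒≢ (<-trans (≰⇒> i≰lo) (n<1+n i)) ∘ sym) (<⇒≢ (≰⇒> i≰lo) ∘ sym ∘ suc-injective)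

s∘middle-hi : ∀ {lo hi} i → 1 ≤ lo → lo < hi → s hi (middle lo hi i) ≡ middle lo (suc hi) i
s∘middle-hi {lo} {hi} i lo≥1 lo<hi with i ≤? lo
... | yes i≤lo rewrite middle-≤lo {lo} {hi} i≤lo | middle-≤lo {lo} {suc hi} i≤lo =
        let i∸1<hi = <-trans (≤⇒∸1< lo≥1 i≤lo) lo<hi
        in s-fixed hi (<⇒≢ i∸1<hi) (<⇒≢ (<-trans i∸1<hi (n<1+n hi)))
... | no i≰lo with i <? hi
...   | yes i<hi rewrite middle-between {lo} {hi} (≰⇒> i≰lo) i<hi
                       | middle-between {lo} {suc hi} (≰⇒> i≰lo) (<-trans i<hi (n<1+n hi)) =
          s-fixed hi (<⇒≢ i<hi) (<⇒≢ (<-trans i<hi (n<1+n hi)))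
...   | no i≮hi with i ≟ hi
...     | yes refl rewrite middle-≥hi {lo} {i} (≰⇒> i≰lo) (≤-refl {i})
                         | middle-between {lo} {suc i} (≰⇒> i≰lo) (n<1+n i) =
            s-right i
...     | no i≢hi rewrite middle-≥hi {lo} {hi} (≰⇒> i≰lo) (≮⇒≥ i≮hi)
                        | middle-≥hi {lo} {suc hi} (≰⇒> i≰lo) (≤∧≢⇒< (≮⇒≥ i≮hi) (i≢hi ∘ sym)) =
            s-fixed hi (<⇒≢ (≤-<-trans (≮⇒≥ i≮hi) (n<1+n i)) ∘ sym) (i≢hi ∘ suc-injective)

s∘middle-adjacent : ∀ {lo} i → 1 ≤ lo → s lo (middle lo (suc lo) i) ≡ middle lo (suc lo) i
s∘middle-adjacent {lo} i lo≥1 = let (≢lo , ≢lo+1) = middle-avoids lo≥1 (n<1+n lo) i in s-fixed lo ≢lo ≢lo+1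

framed-identity : ∀ {n} → 1 < n → AgreeOn n id (framed n 1 n 1 n)
framed-identity {n} n>1 i i≥1 i≤n with i ≟ 1 | i ≟ n
... | yes refl | _        = refl
... | no _     | yes refl = sym (FramedValues.framed-last n 1 n 1 n n>1)
... | no i≢1   | no i≢n   = sym (trans (FramedValues.framed-inner n 1 n 1 n i≢1 i≢n)
                                       (middle-between (≤∧≢⇒< i≥1 (i≢1 ∘ sym)) (≤∧≢⇒< i≤n i≢n)))

module _ {n x y lo hi : ℕ} (frame : Frame n x y lo hi) where
  open Frame frame

  private
    F = framed n x y lo hi

  redWords-framed-first : ∀ {a} → 1 ≤ a → suc a ≡ x → y ≡ n → redWords n F ≡ redWords n (s a ∘ F)
  redWords-framed-first {a} a≥1 a+1≡x y≡n =
    redWords-one-descent (framed-inverse frame) a≥1 a<n (framed-descent-first frame a≥1 a+1≡x)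
      λ b b≥1 b<n b≢a → framed-ascent frame b≥1 b<n (λ b+1≡x → b≢a (suc-injective (trans b+1≡x (sym a+1≡x))))
                                                     (λ b≡y → <⇒≢ b<n (trans b≡y y≡n))
    where
    a<n = subst (_≤ n) (sym a+1≡x) x≤n

  redWords-framed-last : y < n → x ≡ 1 ⊎ x ≡ suc y → redWords n F ≡ redWords n (s y ∘ F)
  redWords-framed-last y<n x≡1⊎x≡y+1 =
    redWords-one-descent (framed-inverse frame) y≥1 y<n (framed-descent-last frame y<n)
      λ b b≥1 b<n b≢y → framed-ascent frame b≥1 b<n (b+1≢x b≥1 b≢y x≡1⊎x≡y+1) b≢y
    where
    b+1≢x : ∀ {b} → 1 ≤ b → b ≢ y → x ≡ 1 ⊎ x ≡ suc y → suc b ≢ x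
    b+1≢x b≥1 _   (inj₁ x≡1)   b+1≡x = <⇒≢ (s≤s b≥1) (sym (trans b+1≡x x≡1))
    b+1≢x _   b≢y (inj₂ x≡y+1) b+1≡x = b≢y (suc-injective (trans b+1≡x x≡y+1))

  redWords-framed-both : ∀ {a} → 1 ≤ a → suc a ≡ x → y < n → a ≢ y →
                         redWords n F ≡ redWords n (s a ∘ F) + redWords n (s y ∘ F)
  redWords-framed-both {a} a≥1 a+1≡x y<n a≢y =
    redWords-two-descents (framed-inverse frame)
      a≥1 (subst (_≤ n) (sym a+1≡x) x≤n) (framed-descent-first frame a≥1 a+1≡x)
      y≥1 y<n (framed-descent-last frame y<n) a≢y
      λ b b≥1 b<n b≢a b≢y →
        framed-ascent frame b≥1 b<n (λ b+1≡x → b≢a (suc-injective (trans b+1≡x (sym a+1≡x)))) b≢y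

module _ {n : ℕ} (n>1 : 1 < n) where

  move-first-increasing : ∀ {a y} → 1 ≤ a → suc a < y →
    AgreeOn n (s a ∘ framed n (suc a) y (suc a) y) (framed n a y a y)
  move-first-increasing {a} {y} a≥1 a+1<y = framed-move {lo = suc a} {y} {lo′ = a} {y} a n>1 (s-right a)
    (s-fixed a (<⇒≢ (<-trans (n<1+n a) a+1<y) ∘ sym) (<⇒≢ a+1<y ∘ sym))
    (λ i _ _ → s-flip a (s∘middle-lo i a≥1 a+1<y))

  move-last-increasing : ∀ {x y} → 1 ≤ x → x < y →
    AgreeOn n (s y ∘ framed n x y x y) (framed n x (suc y) x (suc y))
  move-last-increasing {x} {y} x≥1 x<y = framed-move {lo = x} {y} {lo′ = x} {suc y} y n>1
    (s-fixed y (<⇒≢ x<y) (<⇒≢ (<-trans x<y (n<1+n y))))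
    (s-left y) (λ i _ _ → s∘middle-hi i x≥1 x<y)

  move-adjacent : ∀ {y} → 1 ≤ y →
    AgreeOn n (s y ∘ framed n (suc y) y y (suc y)) (framed n y (suc y) y (suc y))
  move-adjacent {y} y≥1 = framed-move {lo = y} {suc y} {lo′ = y} {suc y} y n>1 (s-right y) (s-left y)
    (λ i _ _ → s∘middle-adjacent i y≥1)

  move-first-decreasing : ∀ {a y} → 1 ≤ y → y < a →
    AgreeOn n (s a ∘ framed n (suc a) y y (suc a)) (framed n a y y a)
  move-first-decreasing {a} {y} y≥1 y<a = framed-move {lo = y} {suc a} {lo′ = y} {a} a n>1 (s-right a)
    (s-fixed a (<⇒≢ y<a) (<⇒≢ (<-trans y<a (n<1+n a))))
    (λ i _ _ → s-flip a (s∘middle-hi i y≥1 y<a))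

  move-last-decreasing : ∀ {x y} → 1 ≤ y → suc y < x →
    AgreeOn n (s y ∘ framed n x y y x) (framed n x (suc y) (suc y) x)
  move-last-decreasing {x} {y} y≥1 y+1<x = framed-move {lo = y} {x} {lo′ = suc y} {x} y n>1
    (s-fixed y (<⇒≢ (<-trans (n<1+n y) y+1<x) ∘ sym) (<⇒≢ y+1<x ∘ sym))
    (s-left y) (λ i _ _ → s∘middle-lo i y≥1 y+1<x)


-- Reduced words of the permutations [x, …, y]

-- shuffles α β = C(α + β, α), the number of shuffles of a chain of length α with one of length β.
shuffles : ℕ → ℕ → ℕ
shuffles zero    β       = 1
shuffles (suc α) zero    = 1
shuffles (suc α) (suc β) = shuffles α (suc β) + shuffles (suc α) β

shuffles-zeroʳ : ∀ α → shuffles α 0 ≡ 1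
shuffles-zeroʳ zero    = refl
shuffles-zeroʳ (suc α) = refl

shuffles-oneʳ : ∀ a → shuffles a 1 ≡ suc a
shuffles-oneʳ zero    = refl
shuffles-oneʳ (suc a) = trans (cong (_+ 1) (shuffles-oneʳ a)) (+-comm (suc a) 1)

shuffles-twoʳ : ∀ a → shuffles a 2 ≡ triangle (2 + a)
shuffles-twoʳ zero    = refl
shuffles-twoʳ (suc a) = cong₂ _+_ (shuffles-twoʳ a) (shuffles-oneʳ (suc a))

crossedShuffles : ℕ → ℕ → ℕ → ℕ
crossedShuffles c zero    d = shuffles c d
crossedShuffles c (suc g) d = crossedShuffles c g (suc d) + crossedShuffles (suc c) g d

crossedShuffles-2-0 : ∀ c → crossedShuffles c 2 0 ≡ triangle (4 + c)
crossedShuffles-2-0 c = begin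
  (shuffles c 2 + shuffles (suc c) 1) + (shuffles (suc c) 1 + shuffles (2 + c) 0)
    ≡⟨ cong₂ _+_ (cong₂ _+_ (shuffles-twoʳ c) (shuffles-oneʳ (suc c)))
                 (cong₂ _+_ (shuffles-oneʳ (suc c)) (shuffles-zeroʳ (2 + c))) ⟩
  (triangle (2 + c) + (2 + c)) + ((2 + c) + 1)
    ≡⟨ cong (triangle (3 + c) +_) (+-comm (2 + c) 1) ⟩
  triangle (4 + c) ∎
  where open ≡-Reasoning

-- framed n (1 + α) y (1 + α) y with n = y + β, i.e. [1 + α, 1, …, α, 2 + α, …, y - 1, y + 1, …, n, y]:
-- moving the first entry down and the last entry up are independent chains of α and β steps.
redWords-framed-increasing : ∀ {n} α β y → y + β ≡ n → suc α < y →
                             redWords n (framed n (suc α) y (suc α) y) ≡ shuffles α β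
redWords-framed-increasing {n} zero zero y y+0≡n 1<y =
  trans (cong (λ m → redWords n (framed n 1 m 1 m)) y≡n)
        (redWords-id n (framed-identity (subst (1 <_) y≡n 1<y)))
  where y≡n = trans (sym (+-identityʳ y)) y+0≡n
redWords-framed-increasing {n} (suc α) zero y y+0≡n a+1<y = begin
  redWords n (framed n (2 + α) y (2 + α) y)
    ≡⟨ redWords-framed-first frame (s≤s z≤n) refl y≡n ⟩
  redWords n (s (suc α) ∘ framed n (2 + α) y (2 + α) y)
    ≡⟨ redWords-cong n (move-first-increasing (Frame.n>1 frame) (s≤s z≤n) a+1<y) ⟩
  redWords n (framed n (suc α) y (suc α) y)
    ≡⟨ redWords-framed-increasing α zero y y+0≡n (<-trans (n<1+n _) a+1<y) ⟩
  shuffles α 0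
    ≡⟨ shuffles-zeroʳ α ⟩
  1 ∎
  where
  open ≡-Reasoning
  y≡n = trans (sym (+-identityʳ y)) y+0≡n
  frame = frame-increasing (s≤s z≤n) a+1<y (≤-reflexive y≡n)
redWords-framed-increasing {n} zero (suc β) y y+β+1≡n 1<y = begin
  redWords n (framed n 1 y 1 y)
    ≡⟨ redWords-framed-last frame y<n (inj₁ refl) ⟩
  redWords n (s y ∘ framed n 1 y 1 y)
    ≡⟨ redWords-cong n (move-last-increasing (Frame.n>1 frame) ≤-refl 1<y) ⟩
  redWords n (framed n 1 (suc y) 1 (suc y))
    ≡⟨ redWords-framed-increasing zero β (suc y) (trans (sym (+-suc y β)) y+β+1≡n) (<-trans 1<y (n<1+n y)) ⟩
  1 ∎
  where
  open ≡-Reasoning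
  y<n = subst (y <_) y+β+1≡n (m<m+n y (s≤s z≤n))
  frame = frame-increasing ≤-refl 1<y (<⇒≤ y<n)
redWords-framed-increasing {n} (suc α) (suc β) y y+β+1≡n a+1<y = begin
  redWords n F
    ≡⟨ redWords-framed-both frame (s≤s z≤n) refl y<n (<⇒≢ (<-trans (n<1+n _) a+1<y)) ⟩
  redWords n (s (suc α) ∘ F) + redWords n (s y ∘ F)
    ≡⟨ cong₂ _+_ (redWords-cong n (move-first-increasing (Frame.n>1 frame) (s≤s z≤n) a+1<y))
                 (redWords-cong n (move-last-increasing (Frame.n>1 frame) (s≤s z≤n) a+1<y)) ⟩
  redWords n (framed n (suc α) y (suc α) y) + redWords n (framed n (2 + α) (suc y) (2 + α) (suc y))
    ≡⟨ cong₂ _+_ (redWords-framed-increasing α (suc β) y y+β+1≡n (<-trans (n<1+n _) a+1<y))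
                 (redWords-framed-increasing (suc α) β (suc y) (trans (sym (+-suc y β)) y+β+1≡n)
                                                              (<-trans a+1<y (n<1+n y))) ⟩
  shuffles α (suc β) + shuffles (suc α) β ∎
  where
  open ≡-Reasoning
  F = framed n (2 + α) y (2 + α) y
  y<n = subst (y <_) y+β+1≡n (m<m+n y (s≤s z≤n))
  frame = frame-increasing (s≤s z≤n) a+1<y (<⇒≤ y<n)

-- Here y = 1 + c < x = 2 + g + c. The left descents x - 1 and y coincide when g = 0,
-- and then s_y turns the permutation into one of the increasing family.
redWords-framed-decreasing : ∀ {n} c g d → (suc g + suc c) + d ≡ n →
  redWords n (framed n (suc g + suc c) (suc c) (suc c) (suc g + suc c)) ≡ crossedShuffles c g d
redWords-framed-decreasing {n} c zero d x+d≡n = begin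
  redWords n (framed n (2 + c) (suc c) (suc c) (2 + c))
    ≡⟨ redWords-framed-last frame (<-≤-trans (n<1+n (suc c)) x≤n) (inj₂ refl) ⟩
  redWords n (s (suc c) ∘ framed n (2 + c) (suc c) (suc c) (2 + c))
    ≡⟨ redWords-cong n (move-adjacent (Frame.n>1 frame) (s≤s z≤n)) ⟩
  redWords n (framed n (suc c) (2 + c) (suc c) (2 + c))
    ≡⟨ redWords-framed-increasing c d (2 + c) x+d≡n (n<1+n (suc c)) ⟩
  shuffles c d ∎
  where
  open ≡-Reasoning
  x≤n = subst (2 + c ≤_) x+d≡n (m≤m+n (2 + c) d)
  frame = frame-decreasing (s≤s z≤n) (n<1+n (suc c)) x≤n
redWords-framed-decreasing {n} c (suc g) d x+d≡n = begin
  redWords n F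
    ≡⟨ redWords-framed-both frame (s≤s z≤n) refl y<n (<⇒≢ y<a ∘ sym) ⟩
  redWords n (s a ∘ F) + redWords n (s (suc c) ∘ F)
    ≡⟨ cong₂ _+_ (redWords-cong n (move-first-decreasing (Frame.n>1 frame) (s≤s z≤n) y<a))
                 (redWords-cong n (move-last-decreasing (Frame.n>1 frame) (s≤s z≤n) (s≤s y<a))) ⟩
  redWords n (framed n a (suc c) (suc c) a) + redWords n (framed n (suc a) (2 + c) (2 + c) (suc a))
    ≡⟨ cong₂ _+_ (redWords-framed-decreasing c g (suc d) (trans (+-suc a d) x+d≡n)) last-moved ⟩
  crossedShuffles c g (suc d) + crossedShuffles (suc c) g d ∎
  where
  open ≡-Reasoning
  a = suc g + suc c
  F = framed n (suc a) (suc c) (suc c) (suc a)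
  y<a : suc c < a
  y<a = s≤s (m≤n+m (suc c) g)
  x≤n = subst (suc a ≤_) x+d≡n (m≤m+n (suc a) d)
  y<n = <-≤-trans (<-trans y<a (n<1+n a)) x≤n
  frame = frame-decreasing (s≤s z≤n) (<-trans y<a (n<1+n a)) x≤n
  x′≡x : suc g + (2 + c) ≡ suc a
  x′≡x = cong suc (+-suc g (suc c))
  last-moved : redWords n (framed n (suc a) (2 + c) (2 + c) (suc a)) ≡ crossedShuffles (suc c) g d
  last-moved = subst (λ x → redWords n (framed n x (2 + c) (2 + c) x) ≡ crossedShuffles (suc c) g d) x′≡x
                     (redWords-framed-decreasing (suc c) g d (trans (cong (_+ d) x′≡x) x+d≡n))


module _ (c : ℕ) where
  open FramedValues (4 + c) (4 + c) (suc c) (suc c) (4 + c)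

  nw≗framed : AgreeOn (4 + c) (nw (4 + c)) (framed (4 + c) (4 + c) (suc c) (suc c) (4 + c))
  nw≗framed i i≥1 i≤n with i ≟ 1
  ... | yes refl = refl
  ... | no i≢1 with i ≤? suc c
  ...   | yes i≤c+1
    rewrite framed-inner i≢1 (<⇒≢ (≤-<-trans i≤c+1 (m<n+m (suc c) {3} (s≤s z≤n))))
          | middle-≤lo {suc c} {4 + c} i≤c+1
          | ≡ᵇ-false i≢1 | ≤ᵇ-true (≤∧≢⇒< i≥1 (i≢1 ∘ sym)) | ≤ᵇ-true i≤c+1 = refl
  ...   | no i≰c+1 with i ≟ 2 + c | i ≟ 3 + c | i ≟ 4 + c
  ...     | yes refl | _        | _
    rewrite framed-inner i≢1 (<⇒≢ (m<n+m i {2} (s≤s z≤n)))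
          | middle-between {suc c} {4 + c} (n<1+n (suc c)) (m<n+m i {2} (s≤s z≤n))
          | ≤ᵇ-false i≰c+1 | ≡ᵇ-true (refl {x = i}) = refl
  ...     | no _     | yes refl | _
    rewrite framed-inner i≢1 (<⇒≢ (n<1+n i))
          | middle-between {suc c} {4 + c} (<-trans (n<1+n (suc c)) (n<1+n (2 + c))) (n<1+n i)
          | ≤ᵇ-false i≰c+1 | ≡ᵇ-false (1+n≢n {2 + c}) | ≡ᵇ-true (refl {x = i}) = refl
  ...     | no _     | no _     | yes refl
    rewrite framed-last (s≤s (s≤s z≤n))
          | ≤ᵇ-false i≰c+1 | ≡ᵇ-false (<⇒≢ (m<n+m c {2} (s≤s z≤n)) ∘ sym) | ≡ᵇ-false (1+n≢n {c})
          | ≡ᵇ-true (refl {x = c}) = refl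
  ...     | no i≢c+2 | no i≢c+3 | no i≢c+4 =
    contradiction i≤n (<⇒≱ (≤∧≢⇒< (≤∧≢⇒< (≤∧≢⇒< (≰⇒> i≰c+1) (i≢c+2 ∘ sym)) (i≢c+3 ∘ sym)) (i≢c+4 ∘ sym)))

corollary3p7 : (n : ℕ) → 4 ≤ n → redWords n (nw n) ≡ inv n (nw n) + inv n (σ n)
corollary3p7 (suc (suc (suc (suc c)))) (s≤s (s≤s (s≤s (s≤s z≤n)))) = begin
  redWords n (nw n)           ≡⟨ redWords-cong n (nw≗framed c) ⟩
  redWords n F                ≡⟨ redWords-framed-decreasing c 2 0 (+-identityʳ n) ⟩
  crossedShuffles c 2 0       ≡⟨ crossedShuffles-2-0 c ⟩
  triangle n                  ≡⟨ inv-reverse (InverseOn-agree (nw≗framed c) (framed-inverse frame)) ⟨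
  inv n (nw n) + inv n (σ n)  ∎
  where
  open ≡-Reasoning
  n = 4 + c
  F = framed n n (suc c) (suc c) n
  frame = frame-decreasing (s≤s z≤n) (m<n+m (suc c) {3} (s≤s z≤n)) ≤-refl
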